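{- Let $I$ be a finite set of positive integers, let $A \subseteq \mathbb{F}_2^I$ be an SMD, and let $H \subseteq \mathbb{F}_2^I$ be an affine subspace of dimension $d$. Let $I_d$ be the set of the $d$ smallest elements of $I$. Then: (i) for every $J \subseteq I$, $C_J(H)$ is an affine subspace of dimension $d$; (ii) $H$ is an SMD if and only if $H = \mathbb{F}_2^{I_d}$; (iii) if $H \subseteq A$ then $\mathbb{F}_2^{I_d} \subseteq A$; (iv) if $A \subseteq H$ then $A \subseteq \mathbb{F}_2^{I_d}$; (v) if $A = H$ then $A = \mathbb{F}_2^{I_d}$.
   Context: $\mathbb{F}_2^I$ is the vector space of tuples $(x_i)_{i\in I}$ over $\mathbb{F}_2$ with standard basis $(e_i)_{i\in I}$; for $J\subseteq I$, $\mathbb{F}_2^J$ denotes the coordinate subspace spanned by $\{e_j:j\in J\}$. $A$ is a downset if whenever $x_i=0$ and $x+e_i\in A$ then $x\in A$; shift-minimal if whenever $i<j$, $x_i=x_j=0$, $x+e_j\in A$ then $x+e_i\in A$; an SMD is a shift-minimal downset. Lex order on $\mathbb{F}_2^J$: $x\prec y$ iff at the largest $j$ with $x_j\ne y_j$ one has $x_j=0,y_j=1$. Writing $\mathbb{F}_2^I=\mathbb{F}_2^{I\setminus J}\times\mathbb{F}_2^J$ and, for $A\subseteq\mathbb{F}_2^I$ and $x\in\mathbb{F}_2^{I\setminus J}$, the fibre $A_x=\{y\in\mathbb{F}_2^J:(x,y)\in A\}$, the $J$-compression $C_J(A)$ is the set obtained by replacing each fibre $A_x$ by the set $\overline{A}_x$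 of the first $|A_x|$ elements of $\mathbb{F}_2^J$ in lex order, i.e. $C_J(A)=\{(x,y): y\in\overline{A}_x\}$. -}

module Defs where

open import Data.Bool using (Bool; true; false; _∧_; _∨_; not; _xor_; if_then_else_)
open import Data.Nat using (ℕ; zero; suc; _<ᵇ_; _<_; _+_)
open import Data.Fin using (Fin; toℕ)
open import Data.Fin.Subset using (Subset)
open import Data.Vec using (Vec; []; _∷_; zipWith; replicate; lookup; tabulate; foldr)
open import Data.Vec.Properties using (≡-dec)
open import Data.Bool.Properties using () renaming (_≟_ to _≟B_)
open import Data.List using (List; []; _∷_; _++_; map; filter; length)
open import Data.Product using (Σ; _×_; _,_)
open import Relation.Binary.PropositionalEquality using (_≡_)
open import Relation.Nullary.Decidable using (⌊_⌋)
open import Function.Bundles using (_⇔_)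

-- The index set I (a finite set of positive integers) is modelled by Fin n,
-- with its natural order (only the relative order of I matters).
Pt : ℕ → Set
Pt n = Vec Bool n

PSet : ℕ → Set
PSet n = Pt n → Bool

_∈_ : ∀ {n} → Pt n → PSet n → Set
x ∈ A = A x ≡ true

_⊆_ : ∀ {n} → PSet n → PSet n → Set
A ⊆ B = ∀ x → x ∈ A → x ∈ B

_≐_ : ∀ {n} → PSet n → PSet n → Set
A ≐ B = ∀ x → A x ≡ B x

_⊕_ : ∀ {n} → Pt n → Pt n → Pt n
_⊕_ = zipWith _xor_

𝟎 : ∀ {n} → Pt n
𝟎 = replicate _ false

e : ∀ {n} → Fin n → Pt n
e i = tabulate (λ j → ⌊ Data.Fin._≟_ j i ⌋)

IsDownset : ∀ {n} → PSet n → Set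
IsDownset {n} A = ∀ (x : Pt n) (i : Fin n) → lookup x i ≡ false → (x ⊕ e i) ∈ A → x ∈ A

IsShiftMinimal : ∀ {n} → PSet n → Set
IsShiftMinimal {n} A = ∀ (x : Pt n) (i j : Fin n) → toℕ i < toℕ j →
  lookup x i ≡ false → lookup x j ≡ false → (x ⊕ e j) ∈ A → (x ⊕ e i) ∈ A

IsSMD : ∀ {n} → PSet n → Set
IsSMD A = IsDownset A × IsShiftMinimal A

lincomb : ∀ {n d} → Vec Bool d → Vec (Pt n) d → Pt n
lincomb [] [] = 𝟎
lincomb (c ∷ cs) (w ∷ ws) = (if c then w else 𝟎) ⊕ lincomb cs ws

LinIndep : ∀ {n d} → Vec (Pt n) d → Set
LinIndep {n} {d} ws = ∀ (c : Vec Bool d) → lincomb c ws ≡ 𝟎 → c ≡ replicate d false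

IsAffine : ∀ {n} → ℕ → PSet n → Set
IsAffine {n} d H = Σ (Pt n) λ v → Σ (Vec (Pt n) d) λ ws → LinIndep ws ×
  (∀ z → (z ∈ H) ⇔ Σ (Vec Bool d) (λ c → z ≡ v ⊕ lincomb c ws))

-- F₂^{I_d}: coordinate subspace on the d smallest indices
cube : ∀ {n} → ℕ → PSet n
cube {n} d z = foldr _ _∧_ true (tabulate (λ i → (toℕ i <ᵇ d) ∨ not (lookup z i)))

allPts : (n : ℕ) → List (Pt n)
allPts zero = [] ∷ []
allPts (suc n) = map (false ∷_) (allPts n) ++ map (true ∷_) (allPts n)

count : ∀ {n} → (Pt n → Bool) → ℕ
count {n} P = length (Data.List.filter (λ x → P x Data.Bool.Properties.≟ true) (allPts n))

_==_ : ∀ {n} → Pt n → Pt n → Bool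
x == y = ⌊ ≡-dec _≟B_ x y ⌋

-- lex order on vectors: compare at the largest index where they differ
lexLt : ∀ {n} → Pt n → Pt n → Bool
lexLt [] [] = false
lexLt (a ∷ x) (b ∷ y) = if x == y then not a ∧ b else lexLt x y

-- projection onto F₂^J (zeroing coordinates outside J) and onto F₂^{I∖J}
projIn : ∀ {n} → Subset n → Pt n → Pt n
projIn J x = zipWith _∧_ J x

projOut : ∀ {n} → Subset n → Pt n → Pt n
projOut J x = zipWith (λ j b → not j ∧ b) J x

-- J-compression: z = (x,y) lies in C_J(A) iff y is among the first |A_x| elements
-- of F₂^J in lex order, i.e. fewer than |A_x| elements of F₂^J are lex-below y.
C : ∀ {n} → Subset n → PSet n → PSet n
C J A z = count (λ w → (projOut J w == projOut J z) ∧ lexLt (projIn J w) (projIn J z))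
          <ᵇ count (λ w → (projOut J w == projOut J z) ∧ A w)

{-# OPTIONS --safe #-}

-- An affine subspace of F₂^(n+1) either lies in one of the hyperplanes x₀ = 0, x₀ = 1, or meets
-- both of them in two translates of a subspace of one dimension less (`Aff`); every part is proved
-- by induction along this splitting.
--
-- (i) All nonempty J-fibres of H have the same size 2^k, and the points with nonempty fibre form a
-- cylinder over an affine subspace of dimension d - k.  The lex position of a point in its fibre is
-- the binary numeral of its J-coordinates, so C_J(H) keeps exactly the points of that cylinder whose
-- J-coordinates vanish beyond the k smallest ones: again an affine subspace of dimension d.
--
-- (iii), (iv) Both halves of an SMD are SMDs, the upper half lies inside the lower one, and moving
-- a 1 from any coordinate to x₀ keeps a point inside the SMD.  Hence an SMD containing H contains
-- the cube on the first d coordinates, and an SMD inside H lies inside that cube.  Cubes are SMDs,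
-- so (ii) and (v) follow from (iii) and (iv).

module Submission where

open import Defs
open import Data.Nat using (ℕ)
open import Data.Fin.Subset using (Subset)
open import Data.Product using (_×_)
open import Function.Bundles using (_⇔_)

open import Algebra.Bundles using (CommutativeSemigroup)
open import Algebra.Definitions using (Associative; Commutative; LeftIdentity; RightIdentity)
import Algebra.Properties.CommutativeSemigroup as CommutativeSemigroupProperties
open import Data.Bool using (Bool; true; false; _∧_; _∨_; not; _xor_; if_then_else_)
open import Data.Bool.Properties
  using ( xor-assoc; xor-comm; xor-identityʳ; xor-same; ∧-assoc; ∧-identityʳ; ∧-zeroʳ; ∧-inverseˡ
        ; ∧-conicalˡ; ∧-conicalʳ; ∧-distribˡ-∨; ∧-distribʳ-∨; ∨-identityʳ; ∨-zeroʳ; T-≡ )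
  renaming (_≟_ to _≟B_)
open import Data.Fin using (Fin; zero; suc)
import Data.Fin as Fin
open import Data.List using ([]; _∷_; _++_; map; filter; length)
open import Data.List.Properties using (length-++; filter-++)
open import Data.Nat using (zero; suc; _+_; _*_; _^_; _<ᵇ_; _≤_; _<_; z≤n; s≤s; s≤s⁻¹; ≢-nonZero⁻¹)
open import Data.Nat.Properties
  using ( +-identityʳ; +-comm; +-assoc; +-suc; +-commutativeSemigroup; +-monoˡ-≤; *-distribˡ-+
        ; *-monoʳ-≤; *-cancelˡ-<; m^n>0; m^n≢0; ≤-refl; ≤-<-trans; m≤n+m; n<1+n; m≤n⇒m≤1+n
        ; <ᵇ⇒<; <⇒<ᵇ; module ≤-Reasoning )
open import Data.Product using (Σ; _,_; proj₁)
open import Data.Sum using (_⊎_; inj₁; inj₂)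
open import Data.Vec using (Vec; []; _∷_; zipWith; head; tail; lookup; replicate)
import Data.Vec as Vec
open import Data.Vec.Properties
  using (≡-dec; ∷-injectiveˡ; ∷-injectiveʳ; tabulate-cong; tabulate∘lookup; lookup-replicate)
open import Data.Vec.Relation.Binary.Pointwise.Inductive
  using (Pointwise-≡⇒≡; zipWith-assoc; zipWith-comm; zipWith-identityˡ; zipWith-identityʳ)
open import Function.Bundles using (mk⇔; Equivalence)
open import Relation.Binary.PropositionalEquality
open import Relation.Binary.PropositionalEquality.Algebra using (isMagma)
open import Relation.Nullary using (yes; no; does; contradiction)
open import Relation.Nullary.Decidable using (⌊_⌋; isYes≗does)
open import Relation.Unary using (Pred; Decidable)

open CommutativeSemigroupProperties +-commutativeSemigroup using () renaming (interchange to +-interchange)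

bool-ext : ∀ {a b : Bool} → (a ≡ true → b ≡ true) → (b ≡ true → a ≡ true) → a ≡ b
bool-ext {false} {false} _ _ = refl
bool-ext {false} {true}  _ g = g refl
bool-ext {true}  {false} f _ = sym (f refl)
bool-ext {true}  {true}  _ _ = refl

∧-distribˡ-∨-∧ : ∀ x y z u → x ∧ ((y ∧ z) ∨ u) ≡ (y ∧ (x ∧ z)) ∨ (x ∧ u)
∧-distribˡ-∨-∧ true  y     z u = refl
∧-distribˡ-∨-∧ false true  z u = refl
∧-distribˡ-∨-∧ false false z u = refl

-- Vectors over F₂

⊕-assoc : ∀ {n} → Associative _≡_ (_⊕_ {n})
⊕-assoc x y z = Pointwise-≡⇒≡ (zipWith-assoc xor-assoc x y z)

⊕-comm : ∀ {n} → Commutative _≡_ (_⊕_ {n})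
⊕-comm x y = Pointwise-≡⇒≡ (zipWith-comm xor-comm x y)

⊕-identityˡ : ∀ {n} → LeftIdentity _≡_ 𝟎 (_⊕_ {n})
⊕-identityˡ x = Pointwise-≡⇒≡ (zipWith-identityˡ (λ _ → refl) x)

⊕-identityʳ : ∀ {n} → RightIdentity _≡_ 𝟎 (_⊕_ {n})
⊕-identityʳ x = Pointwise-≡⇒≡ (zipWith-identityʳ xor-identityʳ x)

⊕-self : ∀ {n} (x : Pt n) → x ⊕ x ≡ 𝟎
⊕-self []      = refl
⊕-self (a ∷ x) = cong₂ _∷_ (xor-same a) (⊕-self x)

⊕-commutativeSemigroup : ℕ → CommutativeSemigroup _ _
⊕-commutativeSemigroup n = record
  { isCommutativeSemigroup = record
    { isSemigroup = record { isMagma = isMagma (_⊕_ {n}) ; assoc = ⊕-assoc }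
    ; comm        = ⊕-comm
    }
  }

module ⊕-Properties {n : ℕ} = CommutativeSemigroupProperties (⊕-commutativeSemigroup n)
open ⊕-Properties using (xy∙z≈xz∙y; xy∙z≈x∙zy) renaming (interchange to ⊕-interchange)

⊕-cancelʳ : ∀ {n} (x t : Pt n) → (x ⊕ t) ⊕ t ≡ x
⊕-cancelʳ x t = trans (⊕-assoc x t t) (trans (cong (x ⊕_) (⊕-self t)) (⊕-identityʳ x))

⊕-cancelˡ : ∀ {n} (t x : Pt n) → t ⊕ (t ⊕ x) ≡ x
⊕-cancelˡ t x = trans (sym (⊕-assoc t t x)) (trans (cong (_⊕ x) (⊕-self t)) (⊕-identityˡ x))

[x⊕s]⊕[t⊕s]≡x⊕t : ∀ {n} (x s t : Pt n) → (x ⊕ s) ⊕ (t ⊕ s) ≡ x ⊕ t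
[x⊕s]⊕[t⊕s]≡x⊕t x s t =
  trans (sym (⊕-assoc (x ⊕ s) t s)) (trans (xy∙z≈xz∙y (x ⊕ s) t s) (cong (_⊕ t) (⊕-cancelʳ x s)))

==-∷ : ∀ {n} a b (x y : Pt n) → ((a ∷ x) == (b ∷ y)) ≡ ⌊ a ≟B b ⌋ ∧ (x == y)
==-∷ a b x y
  rewrite isYes≗does (a ≟B b) | isYes≗does (≡-dec _≟B_ x y) | isYes≗does (≡-dec _≟B_ (a ∷ x) (b ∷ y))
  = refl

==-sound : ∀ {n} {x y : Pt n} → x == y ≡ true → x ≡ y
==-sound {x = x} {y} p with ≡-dec _≟B_ x y
... | yes x≡y = x≡y

==-complete : ∀ {n} {x y : Pt n} → x ≡ y → x == y ≡ true
==-complete {x = x} {y} x≡y with ≡-dec _≟B_ x y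
... | yes _   = refl
... | no  x≢y = contradiction x≡y x≢y

==-refl : ∀ {n} (x : Pt n) → x == x ≡ true
==-refl x = ==-complete refl

==-⊕ : ∀ {n} (x y t : Pt n) → ((x ⊕ t) == y) ≡ (x == (y ⊕ t))
==-⊕ x y t = bool-ext (λ p → ==-complete (trans (sym (⊕-cancelʳ x t)) (cong (_⊕ t) (==-sound p))))
                      (λ p → ==-complete (trans (cong (_⊕ t) (==-sound p)) (⊕-cancelʳ y t)))

-- Counting points

bit : Bool → ℕ
bit b = if b then 1 else 0

card : ∀ n → (Pt n → Bool) → ℕ
card zero    P = bit (P [])
card (suc n) P = card n (λ x → P (false ∷ x)) + card n (λ x → P (true ∷ x))

length-filter-map : ∀ {a b p} {A : Set a} {B : Set b} {P : Pred B p} (P? : Decidable P) (f : A → B) xs →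
                    length (filter P? (map f xs)) ≡ length (filter (λ x → P? (f x)) xs)
length-filter-map P? f []       = refl
length-filter-map P? f (x ∷ xs) with does (P? (f x))
... | true  = cong suc (length-filter-map P? f xs)
... | false = length-filter-map P? f xs

count≡card : ∀ {n} (P : Pt n → Bool) → count P ≡ card n P
count≡card {zero} P with P []
... | true  = refl
... | false = refl
count≡card {suc n} P = begin
  length (filter P? (map (false ∷_) (allPts n) ++ map (true ∷_) (allPts n)))
    ≡⟨ cong length (filter-++ P? (map (false ∷_) (allPts n)) _) ⟩
  length (filter P? (map (false ∷_) (allPts n)) ++ filter P? (map (true ∷_) (allPts n)))
    ≡⟨ length-++ (filter P? (map (false ∷_) (allPts n))) ⟩
  length (filter P? (map (false ∷_) (allPts n))) + length (filter P? (map (true ∷_) (allPts n)))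
    ≡⟨ cong₂ _+_ (length-filter-map P? (false ∷_) (allPts n)) (length-filter-map P? (true ∷_) (allPts n)) ⟩
  count (λ x → P (false ∷ x)) + count (λ x → P (true ∷ x))
    ≡⟨ cong₂ _+_ (count≡card (λ x → P (false ∷ x))) (count≡card (λ x → P (true ∷ x))) ⟩
  card (suc n) P ∎
  where
  open ≡-Reasoning
  P? : Decidable (λ x → P x ≡ true)
  P? x = P x ≟B true

card-cong : ∀ n {P Q : Pt n → Bool} → (∀ x → P x ≡ Q x) → card n P ≡ card n Q
card-cong zero    P≗Q = cong bit (P≗Q [])
card-cong (suc n) P≗Q = cong₂ _+_ (card-cong n (λ x → P≗Q (false ∷ x))) (card-cong n (λ x → P≗Q (true ∷ x)))

card-empty : ∀ n {P : Pt n → Bool} → (∀ x → P x ≡ false) → card n P ≡ 0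
card-empty zero    P≗∅ = cong bit (P≗∅ [])
card-empty (suc n) P≗∅ = cong₂ _+_ (card-empty n (λ x → P≗∅ (false ∷ x))) (card-empty n (λ x → P≗∅ (true ∷ x)))

card-∨-disjoint : ∀ n {P Q : Pt n → Bool} → (∀ x → P x ∧ Q x ≡ false) →
                  card n (λ x → P x ∨ Q x) ≡ card n P + card n Q
card-∨-disjoint zero {P} {Q} disjoint with P [] | Q [] | disjoint []
... | true  | false | _ = refl
... | false | true  | _ = refl
... | false | false | _ = refl
card-∨-disjoint (suc n) {P} {Q} disjoint =
  trans (cong₂ _+_ (card-∨-disjoint n (λ x → disjoint (false ∷ x)))
                   (card-∨-disjoint n (λ x → disjoint (true ∷ x))))
        (+-interchange (card n (λ x → P (false ∷ x))) _ _ _)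

card-translate : ∀ n (P : Pt n → Bool) (t : Pt n) → card n (λ x → P (x ⊕ t)) ≡ card n P
card-translate zero    P []          = refl
card-translate (suc n) P (false ∷ t) =
  cong₂ _+_ (card-translate n (λ x → P (false ∷ x)) t) (card-translate n (λ x → P (true ∷ x)) t)
card-translate (suc n) P (true ∷ t)  =
  trans (cong₂ _+_ (card-translate n (λ x → P (true ∷ x)) t) (card-translate n (λ x → P (false ∷ x)) t))
        (+-comm (card n (λ x → P (true ∷ x))) _)

card-head : ∀ n b (P : Pt (suc n) → Bool) →
            card (suc n) (λ z → ⌊ head z ≟B b ⌋ ∧ P z) ≡ card n (λ w → P (b ∷ w))
card-head n false P = trans (cong (card n (λ w → P (false ∷ w)) +_) (card-empty n (λ _ → refl))) (+-identityʳ _)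
card-head n true  P = cong (_+ card n (λ w → P (true ∷ w))) (card-empty n (λ _ → refl))

card-singleton : ∀ n (z : Pt n) → card n (_== z) ≡ 1
card-singleton zero    []          = refl
card-singleton (suc n) (false ∷ z) =
  trans (cong₂ _+_ (card-cong n (λ x → ==-∷ false false x z)) (card-empty n (λ x → ==-∷ true false x z)))
        (trans (+-identityʳ _) (card-singleton n z))
card-singleton (suc n) (true ∷ z)  =
  trans (cong₂ _+_ (card-empty n (λ x → ==-∷ false true x z)) (card-cong n (λ x → ==-∷ true true x z)))
        (card-singleton n z)

card-∧-singleton : ∀ n b (x : Pt n) → card n (λ w → b ∧ (w == x)) ≡ bit b
card-∧-singleton n true  x = card-singleton n x
card-∧-singleton n false x = card-empty n (λ _ → refl)

∧-singleton-disjoint : ∀ {n} (P : Pt n → Bool) b {x : Pt n} → P x ≡ false → ∀ w → (b ∧ (w == x)) ∧ P w ≡ false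
∧-singleton-disjoint P b {x} Px≡false w with w == x in w==x
... | true  rewrite ==-sound w==x | Px≡false = ∧-zeroʳ _
... | false = cong (_∧ P w) (∧-zeroʳ b)

-- Lexicographic rank within a fibre

projOut-⊕ : ∀ {n} (J : Subset n) (x y : Pt n) → projOut J (x ⊕ y) ≡ projOut J x ⊕ projOut J y
projOut-⊕ []          []      []      = refl
projOut-⊕ (false ∷ J) (a ∷ x) (b ∷ y) = cong ((a xor b) ∷_) (projOut-⊕ J x y)
projOut-⊕ (true ∷ J)  (a ∷ x) (b ∷ y) = cong (false ∷_) (projOut-⊕ J x y)

projOut-idem : ∀ {n} (J : Subset n) (x : Pt n) → projOut J (projOut J x) ≡ projOut J x
projOut-idem []          []      = refl
projOut-idem (false ∷ J) (a ∷ x) = cong (a ∷_) (projOut-idem J x)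
projOut-idem (true ∷ J)  (a ∷ x) = cong (false ∷_) (projOut-idem J x)

projOut-⊕-projOut : ∀ {n} (J : Subset n) (x t : Pt n) → projOut J (x ⊕ projOut J t) ≡ projOut J (x ⊕ t)
projOut-⊕-projOut J x t = begin
  projOut J (x ⊕ projOut J t)           ≡⟨ projOut-⊕ J x (projOut J t) ⟩
  projOut J x ⊕ projOut J (projOut J t) ≡⟨ cong (projOut J x ⊕_) (projOut-idem J t) ⟩
  projOut J x ⊕ projOut J t             ≡⟨ projOut-⊕ J x t ⟨
  projOut J (x ⊕ t)                     ∎
  where open ≡-Reasoning

projOut-projIn-injective : ∀ {n} (J : Subset n) {w x : Pt n} →
                           projOut J w ≡ projOut J x → projIn J w ≡ projIn J x → w ≡ x
projOut-projIn-injective []          {[]}    {[]}    _ _ = refl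
projOut-projIn-injective (false ∷ J) {a ∷ w} {b ∷ x} p q =
  cong₂ _∷_ (∷-injectiveˡ p) (projOut-projIn-injective J (∷-injectiveʳ p) (∷-injectiveʳ q))
projOut-projIn-injective (true ∷ J)  {a ∷ w} {b ∷ x} p q =
  cong₂ _∷_ (∷-injectiveˡ q) (projOut-projIn-injective J (∷-injectiveʳ p) (∷-injectiveʳ q))

==-projOut-projIn : ∀ {n} (J : Subset n) (w x : Pt n) →
                    (w == x) ≡ (projOut J w == projOut J x) ∧ (projIn J w == projIn J x)
==-projOut-projIn J w x = bool-ext to from
  where
  to : w == x ≡ true → (projOut J w == projOut J x) ∧ (projIn J w == projIn J x) ≡ true
  to p rewrite ==-sound p | ==-refl (projOut J x) = ==-refl (projIn J x)
  from : (projOut J w == projOut J x) ∧ (projIn J w == projIn J x) ≡ true → w == x ≡ true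
  from p = ==-complete (projOut-projIn-injective J (==-sound (∧-conicalˡ _ _ p)) (==-sound (∧-conicalʳ _ _ p)))

-- The lex position of z within its J-fibre: the J-coordinates as a binary numeral, least significant first.
rank : ∀ {n} → Subset n → Pt n → ℕ
rank []          []      = 0
rank (false ∷ J) (b ∷ x) = rank J x
rank (true ∷ J)  (b ∷ x) = bit b + 2 * rank J x

rank-projOut : ∀ {n} (J : Subset n) (x : Pt n) → rank J (projOut J x) ≡ 0
rank-projOut []          []      = refl
rank-projOut (false ∷ J) (b ∷ x) = rank-projOut J x
rank-projOut (true ∷ J)  (b ∷ x) = cong (2 *_) (rank-projOut J x)

rank-⊕-projOut : ∀ {n} (J : Subset n) (x t : Pt n) → rank J (x ⊕ projOut J t) ≡ rank J x
rank-⊕-projOut []          []      []      = refl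
rank-⊕-projOut (false ∷ J) (b ∷ x) (c ∷ t) = rank-⊕-projOut J x t
rank-⊕-projOut (true ∷ J)  (b ∷ x) (c ∷ t) =
  cong₂ (λ b′ r → bit b′ + 2 * r) (xor-identityʳ b) (rank-⊕-projOut J x t)

lexLt-irrefl : ∀ {n} (x : Pt n) → lexLt x x ≡ false
lexLt-irrefl []      = refl
lexLt-irrefl (a ∷ x) rewrite ==-refl x = ∧-inverseˡ a

lexLt-∷ : ∀ {n} a b (x y : Pt n) → lexLt (a ∷ x) (b ∷ y) ≡ ((not a ∧ b) ∧ (x == y)) ∨ lexLt x y
lexLt-∷ a b x y with x == y in x==y
... | true  rewrite ==-sound x==y | lexLt-irrefl y = sym (trans (∨-identityʳ _) (∧-identityʳ _))
... | false = sym (cong (_∨ lexLt x y) (∧-zeroʳ _))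

lexBelow : ∀ {n} → Subset n → Pt n → Pt n → Bool
lexBelow J z w = (projOut J w == projOut J z) ∧ lexLt (projIn J w) (projIn J z)

lexBelow-irrefl : ∀ {n} (J : Subset n) (x : Pt n) → lexBelow J x x ≡ false
lexBelow-irrefl J x = trans (cong ((projOut J x == projOut J x) ∧_) (lexLt-irrefl (projIn J x))) (∧-zeroʳ _)

lexBelow-out : ∀ {n} (J : Subset n) b (x : Pt n) c w →
               lexBelow (false ∷ J) (b ∷ x) (c ∷ w) ≡ ⌊ c ≟B b ⌋ ∧ lexBelow J x w
lexBelow-out J b x c w =
  trans (cong₂ _∧_ (==-∷ c b (projOut J w) (projOut J x)) (lexLt-∷ false false (projIn J w) (projIn J x)))
        (∧-assoc ⌊ c ≟B b ⌋ (projOut J w == projOut J x) (lexLt (projIn J w) (projIn J x)))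

lexBelow-in : ∀ {n} (J : Subset n) b (x : Pt n) c w →
              lexBelow (true ∷ J) (b ∷ x) (c ∷ w) ≡ ((not c ∧ b) ∧ (w == x)) ∨ lexBelow J x w
lexBelow-in J b x c w = begin
  ((false ∷ projOut J w) == (false ∷ projOut J x)) ∧ lexLt (c ∷ projIn J w) (b ∷ projIn J x)
    ≡⟨ cong₂ _∧_ (==-∷ false false (projOut J w) (projOut J x)) (lexLt-∷ c b (projIn J w) (projIn J x)) ⟩
  (projOut J w == projOut J x) ∧ (((not c ∧ b) ∧ (projIn J w == projIn J x)) ∨ lexLt (projIn J w) (projIn J x))
    ≡⟨ ∧-distribˡ-∨-∧ (projOut J w == projOut J x) (not c ∧ b) _ _ ⟩
  ((not c ∧ b) ∧ ((projOut J w == projOut J x) ∧ (projIn J w == projIn J x))) ∨ lexBelow J x w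
    ≡⟨ cong (λ e → ((not c ∧ b) ∧ e) ∨ lexBelow J x w) (==-projOut-projIn J w x) ⟨
  ((not c ∧ b) ∧ (w == x)) ∨ lexBelow J x w ∎
  where open ≡-Reasoning

card-lexBelow : ∀ {n} (J : Subset n) (z : Pt n) → card n (lexBelow J z) ≡ rank J z
card-lexBelow []          []      = refl
card-lexBelow {suc n} (false ∷ J) (b ∷ x) =
  trans (card-cong (suc n) {P = lexBelow (false ∷ J) (b ∷ x)}
                           {Q = λ z → ⌊ head z ≟B b ⌋ ∧ lexBelow J x (tail z)}
                           (λ { (c ∷ w) → lexBelow-out J b x c w }))
        (trans (card-head n b (λ z → lexBelow J x (tail z))) (card-lexBelow J x))
card-lexBelow {suc n} (true ∷ J)  (b ∷ x) = begin
  card n (λ w → lexBelow (true ∷ J) (b ∷ x) (false ∷ w)) + card n (λ w → lexBelow (true ∷ J) (b ∷ x) (true ∷ w))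
    ≡⟨ cong₂ _+_ (card-cong n (lexBelow-in J b x false)) (card-cong n (lexBelow-in J b x true)) ⟩
  card n (λ w → (b ∧ (w == x)) ∨ lexBelow J x w) + card n (lexBelow J x)
    ≡⟨ cong (_+ card n (lexBelow J x))
            (card-∨-disjoint n (∧-singleton-disjoint (lexBelow J x) b (lexBelow-irrefl J x))) ⟩
  (card n (λ w → b ∧ (w == x)) + card n (lexBelow J x)) + card n (lexBelow J x)
    ≡⟨ cong₂ (λ β r → (β + r) + r) (card-∧-singleton n b x) (card-lexBelow J x) ⟩
  (bit b + rank J x) + rank J x
    ≡⟨ +-assoc (bit b) (rank J x) (rank J x) ⟩
  bit b + (rank J x + rank J x)
    ≡⟨ cong (λ r → bit b + (rank J x + r)) (+-identityʳ (rank J x)) ⟨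
  bit b + 2 * rank J x ∎
  where open ≡-Reasoning

fibreSize : ∀ {n} → Subset n → PSet n → Pt n → ℕ
fibreSize {n} J H z = card n (λ w → (projOut J w == projOut J z) ∧ H w)

C-rank : ∀ {n} (J : Subset n) (H : PSet n) (z : Pt n) → C J H z ≡ (rank J z <ᵇ fibreSize J H z)
C-rank J H z = cong₂ _<ᵇ_ (trans (count≡card (lexBelow J z)) (card-lexBelow J z))
                          (count≡card (λ w → (projOut J w == projOut J z) ∧ H w))

fibreSize-cong : ∀ {n} (J : Subset n) {H H′ : PSet n} → (∀ w → H w ≡ H′ w) →
                 ∀ z → fibreSize J H z ≡ fibreSize J H′ z
fibreSize-cong {n} J H≗H′ z = card-cong n (λ w → cong ((projOut J w == projOut J z) ∧_) (H≗H′ w))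

fibreSize-empty : ∀ {n} (J : Subset n) {H : PSet n} → (∀ w → H w ≡ false) → ∀ z → fibreSize J H z ≡ 0
fibreSize-empty {n} J H≗∅ z =
  card-empty n (λ w → trans (cong ((projOut J w == projOut J z) ∧_) (H≗∅ w)) (∧-zeroʳ _))

fibreSize-projOut : ∀ {n} (J : Subset n) (H : PSet n) {z z′ : Pt n} →
                    projOut J z ≡ projOut J z′ → fibreSize J H z ≡ fibreSize J H z′
fibreSize-projOut {n} J H = cong (λ p → card n (λ w → (projOut J w == p) ∧ H w))

fibreSize-translate : ∀ {n} (J : Subset n) (H : PSet n) (t z : Pt n) →
                      fibreSize J (λ w → H (w ⊕ t)) z ≡ fibreSize J H (z ⊕ t)
fibreSize-translate {n} J H t z = begin
  card n (λ w → (projOut J w == projOut J z) ∧ H (w ⊕ t))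
    ≡⟨ card-cong n (λ w → cong (λ u → (projOut J u == projOut J z) ∧ H (w ⊕ t)) (⊕-cancelʳ w t)) ⟨
  card n (λ w → (projOut J ((w ⊕ t) ⊕ t) == projOut J z) ∧ H (w ⊕ t))
    ≡⟨ card-translate n (λ u → (projOut J (u ⊕ t) == projOut J z) ∧ H u) t ⟩
  card n (λ u → (projOut J (u ⊕ t) == projOut J z) ∧ H u)
    ≡⟨ card-cong n (λ u → cong (_∧ H u) (projOut-== u)) ⟩
  card n (λ u → (projOut J u == projOut J (z ⊕ t)) ∧ H u) ∎
  where
  open ≡-Reasoning
  projOut-== : ∀ u → (projOut J (u ⊕ t) == projOut J z) ≡ (projOut J u == projOut J (z ⊕ t))
  projOut-== u rewrite projOut-⊕ J u t | projOut-⊕ J z t = ==-⊕ (projOut J u) (projOut J z) (projOut J t)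

fibreSize-out : ∀ {n} (J : Subset n) (H : PSet (suc n)) b (x : Pt n) →
                fibreSize (false ∷ J) H (b ∷ x) ≡ fibreSize J (λ w → H (b ∷ w)) x
fibreSize-out {n} J H b x =
  trans (card-cong (suc n) {P = λ z → (projOut (false ∷ J) z == (b ∷ projOut J x)) ∧ H z}
                           {Q = λ z → ⌊ head z ≟B b ⌋ ∧ ((projOut J (tail z) == projOut J x) ∧ H z)}
                           (λ { (c ∷ w) → trans (cong (_∧ H (c ∷ w)) (==-∷ c b (projOut J w) (projOut J x)))
                                                (∧-assoc ⌊ c ≟B b ⌋ _ (H (c ∷ w))) }))
        (card-head n b (λ z → (projOut J (tail z) == projOut J x) ∧ H z))

fibreSize-in : ∀ {n} (J : Subset n) (H : PSet (suc n)) b (x : Pt n) →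
               fibreSize (true ∷ J) H (b ∷ x) ≡
               fibreSize J (λ w → H (false ∷ w)) x + fibreSize J (λ w → H (true ∷ w)) x
fibreSize-in {n} J H b x = cong₂ _+_ (card-cong n (same-fibre false)) (card-cong n (same-fibre true))
  where
  same-fibre : ∀ c w → ((false ∷ projOut J w) == (false ∷ projOut J x)) ∧ H (c ∷ w) ≡
                       (projOut J w == projOut J x) ∧ H (c ∷ w)
  same-fibre c w = cong (_∧ H (c ∷ w)) (==-∷ false false (projOut J w) (projOut J x))

-- Affine subspaces, split along the first coordinate

ShiftedHalves : ∀ {n} → PSet (suc n) → Pt n → Set
ShiftedHalves A s = ∀ x → A (true ∷ x) ≡ A (false ∷ (x ⊕ s))

data Aff : {n : ℕ} → ℕ → PSet n → Set where
  point : {A : PSet 0} → [] ∈ A → Aff 0 A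
  only₀ : ∀ {n d} {A : PSet (suc n)} →
          Aff d (λ x → A (false ∷ x)) → (∀ x → A (true ∷ x) ≡ false) → Aff d A
  only₁ : ∀ {n d} {A : PSet (suc n)} →
          (∀ x → A (false ∷ x) ≡ false) → Aff d (λ x → A (true ∷ x)) → Aff d A
  both  : ∀ {n d} {A : PSet (suc n)} →
          Aff d (λ x → A (false ∷ x)) → (s : Pt n) → ShiftedHalves A s → Aff (suc d) A

module _ {n : ℕ} (A : PSet (suc n)) {s : Pt n} (shifted : ShiftedHalves A s) where

  shifted-⊕-assoc : ∀ x t → A (true ∷ (x ⊕ t)) ≡ A (false ∷ (x ⊕ (t ⊕ s)))
  shifted-⊕-assoc x t = trans (shifted (x ⊕ t)) (cong (λ y → A (false ∷ y)) (⊕-assoc x t s))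

  shifted-⊕-swap : ∀ x t → A (true ∷ (x ⊕ t)) ≡ A (false ∷ ((x ⊕ s) ⊕ t))
  shifted-⊕-swap x t = trans (shifted (x ⊕ t)) (cong (λ y → A (false ∷ y)) (xy∙z≈xz∙y x t s))

  shifted-⊕-cancel : ∀ x t → A (true ∷ ((x ⊕ s) ⊕ t)) ≡ A (false ∷ (x ⊕ t))
  shifted-⊕-cancel x t =
    trans (shifted-⊕-assoc (x ⊕ s) t) (cong (λ y → A (false ∷ y)) ([x⊕s]⊕[t⊕s]≡x⊕t x s t))

Aff-cong : ∀ {n d} {A B : PSet n} → Aff d A → (∀ x → A x ≡ B x) → Aff d B
Aff-cong (point p)    A≗B = point (trans (sym (A≗B [])) p)
Aff-cong (only₀ a h)  A≗B =
  only₀ (Aff-cong a (λ x → A≗B (false ∷ x))) (λ x → trans (sym (A≗B (true ∷ x))) (h x))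
Aff-cong (only₁ h a)  A≗B =
  only₁ (λ x → trans (sym (A≗B (false ∷ x))) (h x)) (Aff-cong a (λ x → A≗B (true ∷ x)))
Aff-cong (both a s h) A≗B =
  both (Aff-cong a (λ x → A≗B (false ∷ x))) s
       (λ x → trans (sym (A≗B (true ∷ x))) (trans (h x) (A≗B (false ∷ (x ⊕ s)))))

Aff-dim≤ : ∀ {n d} {A : PSet n} → Aff d A → d ≤ n
Aff-dim≤ (point _)    = z≤n
Aff-dim≤ (only₀ a _)  = m≤n⇒m≤1+n (Aff-dim≤ a)
Aff-dim≤ (only₁ _ a)  = m≤n⇒m≤1+n (Aff-dim≤ a)
Aff-dim≤ (both a _ _) = s≤s (Aff-dim≤ a)

Aff-translate : ∀ {n d} {A : PSet n} → Aff d A → (t : Pt n) → Aff d (λ x → A (x ⊕ t))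
Aff-translate (point p)    []          = point p
Aff-translate (only₀ a h)  (false ∷ t) = only₀ (Aff-translate a t) (λ x → h (x ⊕ t))
Aff-translate (only₀ a h)  (true ∷ t)  = only₁ (λ x → h (x ⊕ t)) (Aff-translate a t)
Aff-translate (only₁ h a)  (false ∷ t) = only₁ (λ x → h (x ⊕ t)) (Aff-translate a t)
Aff-translate (only₁ h a)  (true ∷ t)  = only₀ (Aff-translate a t) (λ x → h (x ⊕ t))
Aff-translate {A = A} (both a s h) (false ∷ t) = both (Aff-translate a t) s (λ x → shifted-⊕-swap A h x t)
Aff-translate {A = A} (both a s h) (true ∷ t)  =
  both (Aff-cong (Aff-translate a (t ⊕ s)) (λ x → sym (shifted-⊕-assoc A h x t))) s
       (λ x → sym (shifted-⊕-cancel A h x t))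

InvariantOrDisjoint : ∀ {n} → PSet n → Pt n → Set
InvariantOrDisjoint A t = (∀ x → A x ≡ A (x ⊕ t)) ⊎ (∀ x → x ∈ A → A (x ⊕ t) ≡ false)

Aff-invariantOrDisjoint : ∀ {n d} {A : PSet n} → Aff d A → (t : Pt n) → InvariantOrDisjoint A t
Aff-invariantOrDisjoint (point _) [] = inj₁ (λ { [] → refl })
Aff-invariantOrDisjoint (only₀ a h) (false ∷ t) with Aff-invariantOrDisjoint a t
... | inj₁ inv  = inj₁ λ { (false ∷ x) → inv x ; (true ∷ x) → trans (h x) (sym (h (x ⊕ t))) }
... | inj₂ disj = inj₂ λ { (false ∷ x) p → disj x p ; (true ∷ x) p → contradiction (trans (sym p) (h x)) λ () }
Aff-invariantOrDisjoint (only₀ a h) (true ∷ t) =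
  inj₂ λ { (false ∷ x) _ → h (x ⊕ t) ; (true ∷ x) p → contradiction (trans (sym p) (h x)) λ () }
Aff-invariantOrDisjoint (only₁ h a) (false ∷ t) with Aff-invariantOrDisjoint a t
... | inj₁ inv  = inj₁ λ { (true ∷ x) → inv x ; (false ∷ x) → trans (h x) (sym (h (x ⊕ t))) }
... | inj₂ disj = inj₂ λ { (true ∷ x) p → disj x p ; (false ∷ x) p → contradiction (trans (sym p) (h x)) λ () }
Aff-invariantOrDisjoint (only₁ h a) (true ∷ t) =
  inj₂ λ { (true ∷ x) _ → h (x ⊕ t) ; (false ∷ x) p → contradiction (trans (sym p) (h x)) λ () }
Aff-invariantOrDisjoint {A = A} (both a s h) (false ∷ t) with Aff-invariantOrDisjoint a t
... | inj₁ inv  = inj₁ λ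
  { (false ∷ x) → inv x
  ; (true ∷ x)  → trans (h x) (trans (inv (x ⊕ s)) (sym (shifted-⊕-swap A h x t))) }
... | inj₂ disj = inj₂ λ
  { (false ∷ x) p → disj x p
  ; (true ∷ x)  p → trans (shifted-⊕-swap A h x t) (disj (x ⊕ s) (trans (sym (h x)) p)) }
Aff-invariantOrDisjoint {A = A} (both a s h) (true ∷ t) with Aff-invariantOrDisjoint a (t ⊕ s)
... | inj₁ inv  = inj₁ λ
  { (false ∷ x) → trans (inv x) (sym (shifted-⊕-assoc A h x t))
  ; (true ∷ x)  → trans (h x) (trans (inv (x ⊕ s)) (cong (λ y → A (false ∷ y)) ([x⊕s]⊕[t⊕s]≡x⊕t x s t))) }
... | inj₂ disj = inj₂ λ
  { (false ∷ x) p → trans (shifted-⊕-assoc A h x t) (disj x p)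
  ; (true ∷ x)  p → trans (cong (λ y → A (false ∷ y)) (sym ([x⊕s]⊕[t⊕s]≡x⊕t x s t)))
                          (disj (x ⊕ s) (trans (sym (h x)) p)) }

Aff-adjoin : ∀ {n d} {X : PSet n} → Aff d X → (w : Pt n) → (∀ x → x ∈ X → X (x ⊕ w) ≡ false) →
             Aff (suc d) (λ x → X x ∨ X (x ⊕ w))
Aff-adjoin (point p) [] disj = contradiction (trans (sym p) (disj [] p)) λ ()
Aff-adjoin (only₀ a h) (false ∷ w) disj =
  only₀ (Aff-adjoin a w (λ x → disj (false ∷ x))) (λ x → cong₂ _∨_ (h x) (h (x ⊕ w)))
Aff-adjoin {X = X} (only₀ a h) (true ∷ w) _ =
  both (Aff-cong a (λ x → sym (drop-upper x))) w
       (λ x → trans (cong (_∨ X (false ∷ (x ⊕ w))) (h x)) (sym (drop-upper (x ⊕ w))))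
  where
  drop-upper : ∀ x → X (false ∷ x) ∨ X (true ∷ (x ⊕ w)) ≡ X (false ∷ x)
  drop-upper x = trans (cong (X (false ∷ x) ∨_) (h (x ⊕ w))) (∨-identityʳ _)
Aff-adjoin (only₁ h a) (false ∷ w) disj =
  only₁ (λ x → cong₂ _∨_ (h x) (h (x ⊕ w))) (Aff-adjoin a w (λ x → disj (true ∷ x)))
Aff-adjoin {X = X} (only₁ h a) (true ∷ w) _ =
  both (Aff-cong (Aff-translate a w) (λ x → cong (_∨ X (true ∷ (x ⊕ w))) (sym (h x)))) w
       (λ x → trans (drop-lower x) (sym (trans (cong (_∨ X (true ∷ ((x ⊕ w) ⊕ w))) (h (x ⊕ w)))
                                                (cong (λ y → X (true ∷ y)) (⊕-cancelʳ x w)))))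
  where
  drop-lower : ∀ x → X (true ∷ x) ∨ X (false ∷ (x ⊕ w)) ≡ X (true ∷ x)
  drop-lower x = trans (cong (X (true ∷ x) ∨_) (h (x ⊕ w))) (∨-identityʳ _)
Aff-adjoin {X = X} (both a s h) (false ∷ w) disj =
  both (Aff-adjoin a w (λ x → disj (false ∷ x))) s (λ x → cong₂ _∨_ (h x) (shifted-⊕-swap X h x w))
Aff-adjoin {X = X} (both a s h) (true ∷ w) disj =
  both (Aff-cong (Aff-adjoin a (w ⊕ s) disj₀) (λ x → cong (X (false ∷ x) ∨_) (sym (shifted-⊕-assoc X h x w)))) s
       (λ x → cong₂ _∨_ (h x) (sym (shifted-⊕-cancel X h x w)))
  where
  disj₀ : ∀ x → (false ∷ x) ∈ X → X (false ∷ (x ⊕ (w ⊕ s))) ≡ false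
  disj₀ x p = trans (sym (shifted-⊕-assoc X h x w)) (disj (false ∷ x) p)

Aff-singleton : ∀ {n} (v : Pt n) → Aff 0 (_== v)
Aff-singleton []          = point refl
Aff-singleton (false ∷ v) =
  only₀ (Aff-cong (Aff-singleton v) (λ x → sym (==-∷ false false x v))) (λ x → ==-∷ true false x v)
Aff-singleton (true ∷ v)  =
  only₁ (λ x → ==-∷ false true x v) (Aff-cong (Aff-singleton v) (λ x → sym (==-∷ true true x v)))

coset : ∀ {n d} → Pt n → Vec (Pt n) d → PSet n
coset v []       z = z == v
coset v (w ∷ ws) z = coset v ws z ∨ coset v ws (z ⊕ w)

scale : ∀ {n} → Bool → Pt n → Pt n
scale c w = if c then w else 𝟎

scale-xor : ∀ {n} a b (w : Pt n) → scale (a xor b) w ≡ scale a w ⊕ scale b w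
scale-xor true  true  w = sym (⊕-self w)
scale-xor true  false w = sym (⊕-identityʳ w)
scale-xor false true  w = sym (⊕-identityˡ w)
scale-xor false false w = sym (⊕-identityˡ 𝟎)

lincomb-xor : ∀ {n d} (c c′ : Vec Bool d) (ws : Vec (Pt n) d) →
              lincomb (zipWith _xor_ c c′) ws ≡ lincomb c ws ⊕ lincomb c′ ws
lincomb-xor []      []       []       = sym (⊕-identityˡ 𝟎)
lincomb-xor (a ∷ c) (b ∷ c′) (w ∷ ws) =
  trans (cong₂ _⊕_ (scale-xor a b w) (lincomb-xor c c′ ws)) (⊕-interchange (scale a w) (scale b w) _ _)

coset-sound : ∀ {n d} (v : Pt n) (ws : Vec (Pt n) d) z → z ∈ coset v ws →
              Σ (Vec Bool d) λ c → z ≡ v ⊕ lincomb c ws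
coset-sound v []       z p = [] , trans (==-sound p) (sym (⊕-identityʳ v))
coset-sound v (w ∷ ws) z p with coset v ws z in z∈
... | true  with coset-sound v ws z z∈
...   | c , z≡ = (false ∷ c) , trans z≡ (cong (v ⊕_) (sym (⊕-identityˡ _)))
coset-sound v (w ∷ ws) z p | false with coset-sound v ws (z ⊕ w) p
...   | c , z⊕w≡ = (true ∷ c) , (begin
  z                        ≡⟨ ⊕-cancelʳ z w ⟨
  (z ⊕ w) ⊕ w              ≡⟨ cong (_⊕ w) z⊕w≡ ⟩
  (v ⊕ lincomb c ws) ⊕ w   ≡⟨ xy∙z≈x∙zy v (lincomb c ws) w ⟩
  v ⊕ (w ⊕ lincomb c ws)   ∎)
  where open ≡-Reasoning

coset-complete : ∀ {n d} (v : Pt n) (ws : Vec (Pt n) d) z (c : Vec Bool d) →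
                 z ≡ v ⊕ lincomb c ws → z ∈ coset v ws
coset-complete v []       z []          z≡ = ==-complete (trans z≡ (⊕-identityʳ v))
coset-complete v (w ∷ ws) z (false ∷ c) z≡ =
  cong (_∨ coset v ws (z ⊕ w)) (coset-complete v ws z c (trans z≡ (cong (v ⊕_) (⊕-identityˡ _))))
coset-complete v (w ∷ ws) z (true ∷ c)  z≡ =
  trans (cong (coset v ws z ∨_) (coset-complete v ws (z ⊕ w) c z⊕w≡)) (∨-zeroʳ _)
  where
  open ≡-Reasoning
  z⊕w≡ : z ⊕ w ≡ v ⊕ lincomb c ws
  z⊕w≡ = begin
    z ⊕ w                        ≡⟨ cong (_⊕ w) z≡ ⟩
    (v ⊕ (w ⊕ lincomb c ws)) ⊕ w ≡⟨ xy∙z≈x∙zy v (w ⊕ lincomb c ws) w ⟩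
    v ⊕ (w ⊕ (w ⊕ lincomb c ws)) ≡⟨ cong (v ⊕_) (⊕-cancelˡ w (lincomb c ws)) ⟩
    v ⊕ lincomb c ws             ∎

LinIndep-tail : ∀ {n d} (w : Pt n) (ws : Vec (Pt n) d) → LinIndep (w ∷ ws) → LinIndep ws
LinIndep-tail w ws indep c c·ws≡𝟎 = ∷-injectiveʳ (indep (false ∷ c) (trans (⊕-identityˡ _) c·ws≡𝟎))

coset-Aff : ∀ {n d} (v : Pt n) (ws : Vec (Pt n) d) → LinIndep ws → Aff d (coset v ws)
coset-Aff v []       _     = Aff-singleton v
coset-Aff v (w ∷ ws) indep = Aff-adjoin (coset-Aff v ws (LinIndep-tail w ws indep)) w disjoint
  where
  disjoint : ∀ x → x ∈ coset v ws → coset v ws (x ⊕ w) ≡ false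
  disjoint x x∈ with coset v ws (x ⊕ w) in x⊕w∈
  ... | false = refl
  ... | true with coset-sound v ws x x∈ | coset-sound v ws (x ⊕ w) x⊕w∈
  ...   | c , x≡ | c′ , x⊕w≡ = contradiction (∷-injectiveˡ (indep (true ∷ zipWith _xor_ c c′) w-dependent)) λ ()
    where
    open ≡-Reasoning
    w≡ : w ≡ lincomb c ws ⊕ lincomb c′ ws
    w≡ = begin
      w                                          ≡⟨ ⊕-cancelˡ x w ⟨
      x ⊕ (x ⊕ w)                                ≡⟨ cong₂ _⊕_ x≡ x⊕w≡ ⟩
      (v ⊕ lincomb c ws) ⊕ (v ⊕ lincomb c′ ws)   ≡⟨ ⊕-interchange v _ v _ ⟩
      (v ⊕ v) ⊕ (lincomb c ws ⊕ lincomb c′ ws)   ≡⟨ cong (_⊕ _) (⊕-self v) ⟩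
      𝟎 ⊕ (lincomb c ws ⊕ lincomb c′ ws)         ≡⟨ ⊕-identityˡ _ ⟩
      lincomb c ws ⊕ lincomb c′ ws               ∎
    w-dependent : lincomb (true ∷ zipWith _xor_ c c′) (w ∷ ws) ≡ 𝟎
    w-dependent = trans (cong₂ _⊕_ w≡ (lincomb-xor c c′ ws)) (⊕-self _)

IsAffine⇒Aff : ∀ {n d} {H : PSet n} → IsAffine d H → Aff d H
IsAffine⇒Aff {H = H} (v , ws , indep , mem) =
  Aff-cong (coset-Aff v ws indep) (λ z → bool-ext (coset⊆H z) (H⊆coset z))
  where
  coset⊆H : coset v ws ⊆ H
  coset⊆H z p = Equivalence.from (mem z) (coset-sound v ws z p)
  H⊆coset : H ⊆ coset v ws
  H⊆coset z p with Equivalence.to (mem z) p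
  ... | c , z≡ = coset-complete v ws z c z≡

AffineBasis : ∀ {n} → ℕ → PSet n → Set
AffineBasis {n} d H = Σ (Pt n) λ v → Σ (Vec (Pt n) d) λ ws → LinIndep ws × (∀ z → H z ≡ coset v ws z)

AffineBasis⇒IsAffine : ∀ {n d} {H : PSet n} → AffineBasis d H → IsAffine d H
AffineBasis⇒IsAffine (v , ws , indep , H≗coset) =
  v , ws , indep , λ z → mk⇔ (λ p → coset-sound v ws z (trans (sym (H≗coset z)) p))
                             (λ { (c , z≡) → trans (H≗coset z) (coset-complete v ws z c z≡) })

lincomb-map-false∷ : ∀ {n d} (c : Vec Bool d) (ws : Vec (Pt n) d) →
                     lincomb c (Vec.map (false ∷_) ws) ≡ false ∷ lincomb c ws
lincomb-map-false∷ []          []       = refl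
lincomb-map-false∷ (true ∷ c)  (w ∷ ws) = cong ((false ∷ w) ⊕_) (lincomb-map-false∷ c ws)
lincomb-map-false∷ (false ∷ c) (w ∷ ws) = cong (𝟎 ⊕_) (lincomb-map-false∷ c ws)

LinIndep-map-false∷ : ∀ {n d} (ws : Vec (Pt n) d) → LinIndep ws → LinIndep (Vec.map (false ∷_) ws)
LinIndep-map-false∷ ws indep c c·ws≡𝟎 = indep c (∷-injectiveʳ (trans (sym (lincomb-map-false∷ c ws)) c·ws≡𝟎))

coset-map-false∷ : ∀ {n d} a (v : Pt n) (ws : Vec (Pt n) d) b x →
                   coset (a ∷ v) (Vec.map (false ∷_) ws) (b ∷ x) ≡ ⌊ b ≟B a ⌋ ∧ coset v ws x
coset-map-false∷ a v []       b x = ==-∷ b a x v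
coset-map-false∷ a v (w ∷ ws) b x
  rewrite coset-map-false∷ a v ws b x | coset-map-false∷ a v ws (b xor false) (x ⊕ w) | xor-identityʳ b
  = sym (∧-distribˡ-∨ ⌊ b ≟B a ⌋ _ _)

Aff⇒AffineBasis : ∀ {n d} {H : PSet n} → Aff d H → AffineBasis d H
Aff⇒AffineBasis (point p) = [] , [] , (λ { [] _ → refl }) , λ { [] → p }
Aff⇒AffineBasis {H = H} (only₀ a h) with Aff⇒AffineBasis a
... | v , ws , indep , H₀≗coset = (false ∷ v) , Vec.map (false ∷_) ws , LinIndep-map-false∷ ws indep , H≗coset
  where
  H≗coset : ∀ z → H z ≡ coset (false ∷ v) (Vec.map (false ∷_) ws) z
  H≗coset (false ∷ x) = trans (H₀≗coset x) (sym (coset-map-false∷ false v ws false x))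
  H≗coset (true ∷ x)  = trans (h x) (sym (coset-map-false∷ false v ws true x))
Aff⇒AffineBasis {H = H} (only₁ h a) with Aff⇒AffineBasis a
... | v , ws , indep , H₁≗coset = (true ∷ v) , Vec.map (false ∷_) ws , LinIndep-map-false∷ ws indep , H≗coset
  where
  H≗coset : ∀ z → H z ≡ coset (true ∷ v) (Vec.map (false ∷_) ws) z
  H≗coset (false ∷ x) = trans (h x) (sym (coset-map-false∷ true v ws false x))
  H≗coset (true ∷ x)  = trans (H₁≗coset x) (sym (coset-map-false∷ true v ws true x))
Aff⇒AffineBasis {suc n} {suc d} {H} (both a s h) with Aff⇒AffineBasis a
... | v , ws , indep , H₀≗coset = (false ∷ v) , ws′ , indep′ , H≗coset
  where
  ws′ : Vec (Pt (suc n)) (suc d)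
  ws′ = (true ∷ s) ∷ Vec.map (false ∷_) ws
  indep′ : LinIndep ws′
  indep′ (true ∷ c)  c·ws′≡𝟎 =
    contradiction (∷-injectiveˡ (trans (sym (cong ((true ∷ s) ⊕_) (lincomb-map-false∷ c ws))) c·ws′≡𝟎)) λ ()
  indep′ (false ∷ c) c·ws′≡𝟎 = cong (false ∷_) (indep c (trans (sym (⊕-identityˡ _))
    (∷-injectiveʳ (trans (sym (cong (𝟎 ⊕_) (lincomb-map-false∷ c ws))) c·ws′≡𝟎))))
  H≗coset : ∀ z → H z ≡ coset (false ∷ v) ws′ z
  H≗coset (false ∷ x) = begin
    H (false ∷ x)         ≡⟨ H₀≗coset x ⟩
    coset v ws x          ≡⟨ ∨-identityʳ _ ⟨
    coset v ws x ∨ false  ≡⟨ cong₂ _∨_ (coset-map-false∷ false v ws false x)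
                                       (coset-map-false∷ false v ws true (x ⊕ s)) ⟨
    coset (false ∷ v) ws′ (false ∷ x) ∎
    where open ≡-Reasoning
  H≗coset (true ∷ x) = begin
    H (true ∷ x)          ≡⟨ h x ⟩
    H (false ∷ (x ⊕ s))   ≡⟨ H₀≗coset (x ⊕ s) ⟩
    coset v ws (x ⊕ s)    ≡⟨ cong₂ _∨_ (coset-map-false∷ false v ws true x)
                                       (coset-map-false∷ false v ws false (x ⊕ s)) ⟨
    coset (false ∷ v) ws′ (true ∷ x) ∎
    where open ≡-Reasoning

-- Compressions of affine subspaces

<ᵇ-cong : ∀ {m n m′ n′} → (m < n ⇔ m′ < n′) → (m <ᵇ n) ≡ (m′ <ᵇ n′)
<ᵇ-cong {m} {n} {m′} {n′} m<n⇔m′<n′ = bool-ext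
  (λ p → Equivalence.to T-≡ (<⇒<ᵇ (Equivalence.to m<n⇔m′<n′ (<ᵇ⇒< m n (Equivalence.from T-≡ p)))))
  (λ p → Equivalence.to T-≡ (<⇒<ᵇ (Equivalence.from m<n⇔m′<n′ (<ᵇ⇒< m′ n′ (Equivalence.from T-≡ p)))))

<ᵇ-if : ∀ r b k → (r <ᵇ (if b then 2 ^ k else 0)) ≡ b ∧ (r <ᵇ 2 ^ k)
<ᵇ-if r true  k = refl
<ᵇ-if r false k = refl

bit+2*<2*⇔< : ∀ b r p → bit b + 2 * r < 2 * p ⇔ r < p
bit+2*<2*⇔< b r p = mk⇔
  (λ lt → *-cancelˡ-< 2 r p (≤-<-trans (m≤n+m (2 * r) (bit b)) lt))
  (λ r<p → begin-strict
    bit b + 2 * r  ≤⟨ +-monoˡ-≤ (2 * r) (bit≤1 b) ⟩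
    1 + 2 * r      <⟨ n<1+n (1 + 2 * r) ⟩
    2 + 2 * r      ≡⟨ *-distribˡ-+ 2 1 r ⟨
    2 * suc r      ≤⟨ *-monoʳ-≤ 2 r<p ⟩
    2 * p          ∎)
  where
  open ≤-Reasoning
  bit≤1 : ∀ b → bit b ≤ 1
  bit≤1 true  = s≤s z≤n
  bit≤1 false = z≤n

if-2^-injective : ∀ a b k → (if a then 2 ^ k else 0) ≡ (if b then 2 ^ k else 0) → a ≡ b
if-2^-injective true  true  k _  = refl
if-2^-injective false false k _  = refl
if-2^-injective true  false k eq = contradiction eq (≢-nonZero⁻¹ (2 ^ k) {{m^n≢0 2 k}})
if-2^-injective false true  k eq = contradiction (sym eq) (≢-nonZero⁻¹ (2 ^ k) {{m^n≢0 2 k}})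

if-2^-double : ∀ a k → (if a then 2 ^ k else 0) + (if a then 2 ^ k else 0) ≡ (if a then 2 ^ suc k else 0)
if-2^-double true  k = cong (2 ^ k +_) (sym (+-identityʳ (2 ^ k)))
if-2^-double false k = refl

if-2^-disjoint : ∀ a b k → (a ≡ true → b ≡ false) →
                 (if a then 2 ^ k else 0) + (if b then 2 ^ k else 0) ≡ (if a ∨ b then 2 ^ k else 0)
if-2^-disjoint true  true  k a⇒¬b = contradiction (a⇒¬b refl) λ ()
if-2^-disjoint true  false k _    = +-identityʳ _
if-2^-disjoint false b     k _    = refl

lexPrefix : ∀ {n} → Subset n → ℕ → Pt n → Bool
lexPrefix J m z = rank J z <ᵇ 2 ^ m

lexPrefix-in-zero : ∀ {n} (J : Subset n) b (x : Pt n) → lexPrefix (true ∷ J) 0 (b ∷ x) ≡ not b ∧ lexPrefix J 0 x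
lexPrefix-in-zero J true  x = refl
lexPrefix-in-zero J false x with rank J x
... | zero  = refl
... | suc _ = refl

lexPrefix-in-suc : ∀ {n} (J : Subset n) m b (x : Pt n) → lexPrefix (true ∷ J) (suc m) (b ∷ x) ≡ lexPrefix J m x
lexPrefix-in-suc J m b x = <ᵇ-cong (bit+2*<2*⇔< b (rank J x) (2 ^ m))

lexPrefix-projOut : ∀ {n} (J : Subset n) m (x : Pt n) → lexPrefix J m (projOut J x) ≡ true
lexPrefix-projOut J m x rewrite rank-projOut J x = Equivalence.to T-≡ (<⇒<ᵇ (m^n>0 2 m))

lexPrefix-⊕-projOut : ∀ {n} (J : Subset n) m (x t : Pt n) → lexPrefix J m (x ⊕ projOut J t) ≡ lexPrefix J m x
lexPrefix-⊕-projOut J m x t = cong (_<ᵇ 2 ^ m) (rank-⊕-projOut J x t)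

Aff-lexPrefix-in : ∀ {n e k} (J : Subset n) (Q : PSet n) →
                   (∀ m → m ≤ k → Aff (e + m) (λ x → Q x ∧ lexPrefix J m x)) →
                   ∀ m → m ≤ suc k → Aff (e + m) (λ z → Q (tail z) ∧ lexPrefix (true ∷ J) m z)
Aff-lexPrefix-in J Q aff zero _ =
  only₀ (Aff-cong (aff 0 z≤n) (λ x → cong (Q x ∧_) (sym (lexPrefix-in-zero J false x))))
        (λ x → trans (cong (Q x ∧_) (lexPrefix-in-zero J true x)) (∧-zeroʳ (Q x)))
Aff-lexPrefix-in {e = e} J Q aff (suc m) m<1+k =
  subst (λ d → Aff d (λ z → Q (tail z) ∧ lexPrefix (true ∷ J) (suc m) z)) (sym (+-suc e m))
        (both (Aff-cong (aff m (s≤s⁻¹ m<1+k)) (λ x → cong (Q x ∧_) (sym (lexPrefix-in-suc J m false x)))) 𝟎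
              (λ x → trans (halves-equal x)
                           (cong (λ y → Q y ∧ lexPrefix (true ∷ J) (suc m) (false ∷ y)) (sym (⊕-identityʳ x)))))
  where
  halves-equal : ∀ x → Q x ∧ lexPrefix (true ∷ J) (suc m) (true ∷ x) ≡
                       Q x ∧ lexPrefix (true ∷ J) (suc m) (false ∷ x)
  halves-equal x = cong (Q x ∧_) (trans (lexPrefix-in-suc J m true x) (sym (lexPrefix-in-suc J m false x)))

-- The last field is needed for every m ≤ fibreDim, not only for m = fibreDim (which gives C J H),
-- because putting a new lowest coordinate into J shifts all ranks by one binary digit.
record FibreShape {n} (J : Subset n) (d : ℕ) (H : PSet n) : Set where
  field
    fibreDim baseDim      : ℕ
    support               : PSet n
    d≡baseDim+fibreDim    : d ≡ baseDim + fibreDim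
    fibreSize≡            : ∀ z → fibreSize J H z ≡ (if support z then 2 ^ fibreDim else 0)
    Aff-support∧lexPrefix : ∀ m → m ≤ fibreDim → Aff (baseDim + m) (λ z → support z ∧ lexPrefix J m z)

module _ {n d : ℕ} {J : Subset n} {H : PSet n} (S : FibreShape J d H) where
  open FibreShape S

  C-Aff : Aff d (C J H)
  C-Aff = subst (λ d → Aff d (C J H)) (sym d≡baseDim+fibreDim)
                (Aff-cong (Aff-support∧lexPrefix fibreDim ≤-refl) support∧lexPrefix≡C)
    where
    support∧lexPrefix≡C : ∀ z → support z ∧ lexPrefix J fibreDim z ≡ C J H z
    support∧lexPrefix≡C z = sym (begin
      C J H z                                                ≡⟨ C-rank J H z ⟩
      (rank J z <ᵇ fibreSize J H z)                          ≡⟨ cong (rank J z <ᵇ_) (fibreSize≡ z) ⟩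
      (rank J z <ᵇ (if support z then 2 ^ fibreDim else 0))  ≡⟨ <ᵇ-if (rank J z) (support z) fibreDim ⟩
      support z ∧ lexPrefix J fibreDim z                     ∎)
      where open ≡-Reasoning

  support-projOut : ∀ {z z′} → projOut J z ≡ projOut J z′ → support z ≡ support z′
  support-projOut {z} {z′} eq =
    if-2^-injective (support z) (support z′) fibreDim
      (trans (sym (fibreSize≡ z)) (trans (fibreSize-projOut J H eq) (fibreSize≡ z′)))

fibreSize-shifted-half : ∀ {n} (J : Subset n) (H : PSet (suc n)) (s : Pt n) → ShiftedHalves H s →
                         ∀ x → fibreSize J (λ w → H (true ∷ w)) x ≡
                               fibreSize J (λ w → H (false ∷ w)) (x ⊕ projOut J s)
fibreSize-shifted-half J H s h x =
  trans (fibreSize-cong J h x)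
        (trans (fibreSize-translate J (λ w → H (false ∷ w)) s x)
               (fibreSize-projOut J (λ w → H (false ∷ w)) (sym (projOut-⊕-projOut J x s))))

module _ {n d : ℕ} {J : Subset n} {H : PSet (suc n)} where

  FibreShape-only₀-out : (∀ x → H (true ∷ x) ≡ false) → FibreShape J d (λ x → H (false ∷ x)) →
                         FibreShape (false ∷ J) d H
  FibreShape-only₀-out h S = record
    { fibreDim = fibreDim ; baseDim = baseDim ; support = λ z → not (head z) ∧ support (tail z)
    ; d≡baseDim+fibreDim = d≡baseDim+fibreDim
    ; fibreSize≡ = λ { (false ∷ x) → trans (fibreSize-out J H false x) (fibreSize≡ x)
                     ; (true ∷ x)  → trans (fibreSize-out J H true x) (fibreSize-empty J h x) }
    ; Aff-support∧lexPrefix = λ m m≤k → only₀ (Aff-support∧lexPrefix m m≤k) (λ _ → refl)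
    }
    where open FibreShape S

  FibreShape-only₁-out : (∀ x → H (false ∷ x) ≡ false) → FibreShape J d (λ x → H (true ∷ x)) →
                         FibreShape (false ∷ J) d H
  FibreShape-only₁-out h S = record
    { fibreDim = fibreDim ; baseDim = baseDim ; support = λ z → head z ∧ support (tail z)
    ; d≡baseDim+fibreDim = d≡baseDim+fibreDim
    ; fibreSize≡ = λ { (false ∷ x) → trans (fibreSize-out J H false x) (fibreSize-empty J h x)
                     ; (true ∷ x)  → trans (fibreSize-out J H true x) (fibreSize≡ x) }
    ; Aff-support∧lexPrefix = λ m m≤k → only₁ (λ _ → refl) (Aff-support∧lexPrefix m m≤k)
    }
    where open FibreShape S

  FibreShape-only₀-in : (∀ x → H (true ∷ x) ≡ false) → FibreShape J d (λ x → H (false ∷ x)) →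
                        FibreShape (true ∷ J) d H
  FibreShape-only₀-in h S = record
    { fibreDim = fibreDim ; baseDim = baseDim ; support = λ z → support (tail z)
    ; d≡baseDim+fibreDim = d≡baseDim+fibreDim
    ; fibreSize≡ = λ { (b ∷ x) → trans (fibreSize-in J H b x)
                                  (trans (cong (fibreSize J (λ w → H (false ∷ w)) x +_) (fibreSize-empty J h x))
                                         (trans (+-identityʳ _) (fibreSize≡ x))) }
    ; Aff-support∧lexPrefix = λ m m≤k → Aff-lexPrefix-in J support Aff-support∧lexPrefix m (m≤n⇒m≤1+n m≤k)
    }
    where open FibreShape S

  FibreShape-only₁-in : (∀ x → H (false ∷ x) ≡ false) → FibreShape J d (λ x → H (true ∷ x)) →
                        FibreShape (true ∷ J) d H
  FibreShape-only₁-in h S = record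
    { fibreDim = fibreDim ; baseDim = baseDim ; support = λ z → support (tail z)
    ; d≡baseDim+fibreDim = d≡baseDim+fibreDim
    ; fibreSize≡ = λ { (b ∷ x) → trans (fibreSize-in J H b x)
                                  (trans (cong (_+ fibreSize J (λ w → H (true ∷ w)) x) (fibreSize-empty J h x))
                                         (fibreSize≡ x)) }
    ; Aff-support∧lexPrefix = λ m m≤k → Aff-lexPrefix-in J support Aff-support∧lexPrefix m (m≤n⇒m≤1+n m≤k)
    }
    where open FibreShape S

  FibreShape-both-out : (s : Pt n) → ShiftedHalves H s → FibreShape J d (λ x → H (false ∷ x)) →
                        FibreShape (false ∷ J) (suc d) H
  FibreShape-both-out s h S = record
    { fibreDim = fibreDim ; baseDim = suc baseDim
    ; support = λ z → if head z then support (tail z ⊕ projOut J s) else support (tail z)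
    ; d≡baseDim+fibreDim = cong suc d≡baseDim+fibreDim
    ; fibreSize≡ = λ { (false ∷ x) → trans (fibreSize-out J H false x) (fibreSize≡ x)
                     ; (true ∷ x)  → trans (fibreSize-out J H true x)
                                           (trans (fibreSize-shifted-half J H s h x)
                                                  (fibreSize≡ (x ⊕ projOut J s))) }
    ; Aff-support∧lexPrefix = λ m m≤k →
        both (Aff-support∧lexPrefix m m≤k) (projOut J s)
             (λ x → cong (support (x ⊕ projOut J s) ∧_) (sym (lexPrefix-⊕-projOut J m x s)))
    }
    where open FibreShape S

module _ {n d : ℕ} {J : Subset n} {H : PSet (suc n)} (s : Pt n) (h : ShiftedHalves H s)
         (S : FibreShape J d (λ x → H (false ∷ x))) where
  open FibreShape S

  private
    s′ : Pt n
    s′ = projOut J s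

    base : PSet n
    base x = support x ∧ lexPrefix J 0 x

    support≡base-projOut : ∀ x → support x ≡ base (projOut J x)
    support≡base-projOut x = begin
      support x                       ≡⟨ support-projOut S (sym (projOut-idem J x)) ⟩
      support (projOut J x)           ≡⟨ ∧-identityʳ _ ⟨
      support (projOut J x) ∧ true    ≡⟨ cong (support (projOut J x) ∧_) (lexPrefix-projOut J 0 x) ⟨
      base (projOut J x)              ∎
      where open ≡-Reasoning

    base-projOut-shift : ∀ x → base (projOut J x ⊕ s′) ≡ support (x ⊕ s′)
    base-projOut-shift x = begin
      support (projOut J x ⊕ s′) ∧ lexPrefix J 0 (projOut J x ⊕ s′)
        ≡⟨ cong (support (projOut J x ⊕ s′) ∧_)
                (trans (lexPrefix-⊕-projOut J 0 (projOut J x) s) (lexPrefix-projOut J 0 x)) ⟩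
      support (projOut J x ⊕ s′) ∧ true
        ≡⟨ ∧-identityʳ _ ⟩
      support (projOut J x ⊕ s′)
        ≡⟨ support-projOut S (trans (projOut-⊕ J (projOut J x) s′)
                                    (trans (cong (_⊕ projOut J s′) (projOut-idem J x))
                                           (sym (projOut-⊕ J x s′)))) ⟩
      support (x ⊕ s′) ∎
      where open ≡-Reasoning

    fibreSize-both : ∀ b x → fibreSize (true ∷ J) H (b ∷ x) ≡
                     (if support x then 2 ^ fibreDim else 0) + (if support (x ⊕ s′) then 2 ^ fibreDim else 0)
    fibreSize-both b x =
      trans (fibreSize-in J H b x)
            (cong₂ _+_ (fibreSize≡ x) (trans (fibreSize-shifted-half J H s h x) (fibreSize≡ (x ⊕ s′))))

  -- Translation by s′ either preserves the base, and the fibres double, or moves the base off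
  -- itself, and the base gains a dimension.
  FibreShape-both-in : FibreShape (true ∷ J) (suc d) H
  FibreShape-both-in with Aff-invariantOrDisjoint (Aff-support∧lexPrefix 0 z≤n) s′
  ... | inj₁ base-invariant = record
    { fibreDim = suc fibreDim ; baseDim = baseDim ; support = λ z → support (tail z)
    ; d≡baseDim+fibreDim = trans (cong suc d≡baseDim+fibreDim) (sym (+-suc baseDim fibreDim))
    ; fibreSize≡ = λ { (b ∷ x) → trans (fibreSize-both b x)
        (trans (cong (λ c → (if support x then 2 ^ fibreDim else 0) + (if c then 2 ^ fibreDim else 0))
                     (sym (invariant x)))
               (if-2^-double (support x) fibreDim)) }
    ; Aff-support∧lexPrefix = Aff-lexPrefix-in J support Aff-support∧lexPrefix
    }
    where
    invariant : ∀ x → support x ≡ support (x ⊕ s′)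
    invariant x = trans (support≡base-projOut x) (trans (base-invariant (projOut J x)) (base-projOut-shift x))
  ... | inj₂ base-disjoint = record
    { fibreDim = fibreDim ; baseDim = suc baseDim ; support = λ z → support (tail z) ∨ support (tail z ⊕ s′)
    ; d≡baseDim+fibreDim = cong suc d≡baseDim+fibreDim
    ; fibreSize≡ = λ { (b ∷ x) → trans (fibreSize-both b x)
                                       (if-2^-disjoint (support x) (support (x ⊕ s′)) fibreDim (disjoint x)) }
    ; Aff-support∧lexPrefix = λ m m≤k →
        Aff-lexPrefix-in J (λ x → support x ∨ support (x ⊕ s′)) Aff-doubled m (m≤n⇒m≤1+n m≤k)
    }
    where
    disjoint : ∀ x → support x ≡ true → support (x ⊕ s′) ≡ false
    disjoint x p = trans (sym (base-projOut-shift x))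
                         (base-disjoint (projOut J x) (trans (sym (support≡base-projOut x)) p))
    Aff-doubled : ∀ m → m ≤ fibreDim →
                  Aff (suc baseDim + m) (λ x → (support x ∨ support (x ⊕ s′)) ∧ lexPrefix J m x)
    Aff-doubled m m≤k =
      Aff-cong (Aff-adjoin (Aff-support∧lexPrefix m m≤k) s′
                           (λ x p → cong (_∧ lexPrefix J m (x ⊕ s′)) (disjoint x (∧-conicalˡ _ _ p))))
               (λ x → trans (cong (λ i → (support x ∧ lexPrefix J m x) ∨ (support (x ⊕ s′) ∧ i))
                                  (lexPrefix-⊕-projOut J m x s))
                            (sym (∧-distribʳ-∨ (lexPrefix J m x) (support x) (support (x ⊕ s′)))))

fibreShape : ∀ {n d} {H : PSet n} → Aff d H → (J : Subset n) → FibreShape J d H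
fibreShape (point p) [] = record
  { fibreDim = 0 ; baseDim = 0 ; support = λ _ → true ; d≡baseDim+fibreDim = refl
  ; fibreSize≡ = λ { [] → cong bit p } ; Aff-support∧lexPrefix = λ { .0 z≤n → point refl } }
fibreShape (only₀ a h)  (false ∷ J) = FibreShape-only₀-out h (fibreShape a J)
fibreShape (only₀ a h)  (true ∷ J)  = FibreShape-only₀-in h (fibreShape a J)
fibreShape (only₁ h a)  (false ∷ J) = FibreShape-only₁-out h (fibreShape a J)
fibreShape (only₁ h a)  (true ∷ J)  = FibreShape-only₁-in h (fibreShape a J)
fibreShape (both a s h) (false ∷ J) = FibreShape-both-out s h (fibreShape a J)
fibreShape (both a s h) (true ∷ J)  = FibreShape-both-in s h (fibreShape a J)

C-IsAffine : ∀ {n d} {H : PSet n} → IsAffine d H → (J : Subset n) → IsAffine d (C J H)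
C-IsAffine affH J = AffineBasis⇒IsAffine (Aff⇒AffineBasis (C-Aff (fibreShape (IsAffine⇒Aff affH) J)))

-- Shift-minimal downsets

e-zero : ∀ {n} → e {suc n} zero ≡ true ∷ 𝟎
e-zero {n} = cong (true ∷_) (trans (tabulate-cong (λ j → sym (lookup-replicate j false)))
                                   (tabulate∘lookup (replicate n false)))

e-suc : ∀ {n} (i : Fin n) → e (suc i) ≡ false ∷ e i
e-suc i =
  cong (false ∷_) (tabulate-cong (λ j → trans (isYes≗does (suc j Fin.≟ suc i)) (sym (isYes≗does (j Fin.≟ i)))))

∷-⊕-e-zero : ∀ {n} (x : Pt n) → (false ∷ x) ⊕ e zero ≡ true ∷ x
∷-⊕-e-zero x = trans (cong ((false ∷ x) ⊕_) e-zero) (cong (true ∷_) (⊕-identityʳ x))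

∷-⊕-e-suc : ∀ {n} b (x : Pt n) i → (b ∷ x) ⊕ e (suc i) ≡ b ∷ (x ⊕ e i)
∷-⊕-e-suc b x i = trans (cong ((b ∷ x) ⊕_) (e-suc i)) (cong (_∷ (x ⊕ e i)) (xor-identityʳ b))

lookup-⊕-e : ∀ {n} (x : Pt n) j → lookup (x ⊕ e j) j ≡ not (lookup x j)
lookup-⊕-e (b ∷ x) zero    = trans (cong (λ y → lookup ((b ∷ x) ⊕ y) zero) e-zero) (xor-comm b true)
lookup-⊕-e (b ∷ x) (suc j) = trans (cong (λ y → lookup y (suc j)) (∷-⊕-e-suc b x j)) (lookup-⊕-e x j)

module _ {n : ℕ} {A : PSet (suc n)} where

  IsSMD-half : ∀ b → IsSMD A → IsSMD (λ x → A (b ∷ x))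
  IsSMD-half b (down , shift) =
      (λ x i xᵢ≡0 p → down (b ∷ x) (suc i) xᵢ≡0 (subst (_∈ A) (sym (∷-⊕-e-suc b x i)) p))
    , (λ x i j i<j xᵢ≡0 xⱼ≡0 p → subst (_∈ A) (∷-⊕-e-suc b x i)
          (shift (b ∷ x) (suc i) (suc j) (s≤s i<j) xᵢ≡0 xⱼ≡0 (subst (_∈ A) (sym (∷-⊕-e-suc b x j)) p)))

  IsSMD-down₀ : IsSMD A → ∀ x → (true ∷ x) ∈ A → (false ∷ x) ∈ A
  IsSMD-down₀ (down , _) x p = down (false ∷ x) zero refl (subst (_∈ A) (sym (∷-⊕-e-zero x)) p)

  IsSMD-shift₀ : IsSMD A → ∀ x j → lookup x j ≡ false → (false ∷ (x ⊕ e j)) ∈ A → (true ∷ x) ∈ A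
  IsSMD-shift₀ (_ , shift) x j xⱼ≡0 p = subst (_∈ A) (∷-⊕-e-zero x)
    (shift (false ∷ x) zero (suc j) (s≤s z≤n) refl xⱼ≡0 (subst (_∈ A) (sym (∷-⊕-e-suc false x j)) p))

  IsSMD-∷ : IsSMD (λ x → A (false ∷ x)) → IsSMD (λ x → A (true ∷ x)) →
            (∀ x → (true ∷ x) ∈ A → (false ∷ x) ∈ A) →
            (∀ x j → lookup x j ≡ false → (false ∷ (x ⊕ e j)) ∈ A → (true ∷ x) ∈ A) → IsSMD A
  IsSMD-∷ (down₀ , shift₀) (down₁ , shift₁) down-zero shift-zero = down , shift
    where
    down : IsDownset A
    down (false ∷ x) zero    _    p = down-zero x (subst (_∈ A) (∷-⊕-e-zero x) p)
    down (false ∷ x) (suc i) xᵢ≡0 p = down₀ x i xᵢ≡0 (subst (_∈ A) (∷-⊕-e-suc false x i) p)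
    down (true ∷ x)  (suc i) xᵢ≡0 p = down₁ x i xᵢ≡0 (subst (_∈ A) (∷-⊕-e-suc true x i) p)
    shift : IsShiftMinimal A
    shift (false ∷ x) zero    (suc j) _   _    xⱼ≡0 p =
      subst (_∈ A) (sym (∷-⊕-e-zero x)) (shift-zero x j xⱼ≡0 (subst (_∈ A) (∷-⊕-e-suc false x j) p))
    shift (false ∷ x) (suc i) (suc j) i<j xᵢ≡0 xⱼ≡0 p = subst (_∈ A) (sym (∷-⊕-e-suc false x i))
      (shift₀ x i j (s≤s⁻¹ i<j) xᵢ≡0 xⱼ≡0 (subst (_∈ A) (∷-⊕-e-suc false x j) p))
    shift (true ∷ x)  (suc i) (suc j) i<j xᵢ≡0 xⱼ≡0 p = subst (_∈ A) (sym (∷-⊕-e-suc true x i))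
      (shift₁ x i j (s≤s⁻¹ i<j) xᵢ≡0 xⱼ≡0 (subst (_∈ A) (∷-⊕-e-suc true x j) p))

IsSMD-cong : ∀ {n} {A B : PSet n} → IsSMD A → A ≐ B → IsSMD B
IsSMD-cong (down , shift) A≐B =
    (λ x i xᵢ≡0 p → trans (sym (A≐B x)) (down x i xᵢ≡0 (trans (A≐B _) p)))
  , (λ x i j i<j xᵢ≡0 xⱼ≡0 p → trans (sym (A≐B _)) (shift x i j i<j xᵢ≡0 xⱼ≡0 (trans (A≐B _) p)))

cube-suc : ∀ {n} d (z : Pt n) → z ∈ cube d → z ∈ cube (suc d)
cube-suc d       []      _ = refl
cube-suc zero    (b ∷ x) p = ∧-conicalʳ (not b) _ p
cube-suc (suc d) (b ∷ x) p = cube-suc d x p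

cube-zero⊆ : ∀ {n} d (z : Pt n) → z ∈ cube 0 → z ∈ cube d
cube-zero⊆ zero    z p = p
cube-zero⊆ (suc d) z p = cube-suc d z (cube-zero⊆ d z p)

cube-zero-lookup : ∀ {n} (x : Pt n) j → x ∈ cube 0 → lookup x j ≡ false
cube-zero-lookup (false ∷ x) zero    _ = refl
cube-zero-lookup (b ∷ x)     (suc j) p = cube-zero-lookup x j (∧-conicalʳ (not b) _ p)

cube-zero-witness : ∀ {n} (x : Pt n) → cube 0 x ≡ false → Σ (Fin n) λ j → lookup x j ≡ true
cube-zero-witness (true ∷ x)  _ = zero , refl
cube-zero-witness (false ∷ x) p with cube-zero-witness x p
... | j , xⱼ≡1 = suc j , xⱼ≡1

cube-extend : ∀ {n} d (x : Pt n) → d < n → x ∈ cube d →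
              Σ (Fin n) λ j → lookup x j ≡ false × (x ⊕ e j) ∈ cube (suc d)
cube-extend zero    (false ∷ x) _         p = zero , refl , subst (_∈ cube 1) (sym (∷-⊕-e-zero x)) p
cube-extend (suc d) (b ∷ x)     (s≤s d<n) p with cube-extend d x d<n p
... | j , xⱼ≡0 , q = suc j , xⱼ≡0 , subst (_∈ cube (suc (suc d))) (sym (∷-⊕-e-suc b x j)) q

cube-IsSMD : ∀ {n} d → IsSMD (cube {n} d)
cube-IsSMD {zero}  d       = (λ { [] () }) , (λ { [] () })
cube-IsSMD {suc n} zero    = IsSMD-∷ (cube-IsSMD 0) ((λ _ _ _ ()) , (λ _ _ _ _ _ _ ())) (λ _ ()) shift-zero
  where
  shift-zero : ∀ x j → lookup x j ≡ false → (x ⊕ e j) ∈ cube 0 → (true ∷ x) ∈ cube 0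
  shift-zero x j xⱼ≡0 p =
    contradiction (trans (sym (cube-zero-lookup (x ⊕ e j) j p)) (trans (lookup-⊕-e x j) (cong not xⱼ≡0))) λ ()
cube-IsSMD {suc n} (suc d) =
  IsSMD-∷ (cube-IsSMD d) (cube-IsSMD d) (λ _ p → p) (λ x j xⱼ≡0 p → proj₁ (cube-IsSMD d) x j xⱼ≡0 p)

cube⊆-∷ : ∀ {n} d {A : PSet (suc n)} → IsSMD A → d ≤ n → (∀ x → x ∈ cube d → (false ∷ x) ∈ A) → cube d ⊆ A
cube⊆-∷ zero    _   _   h (false ∷ x) p = h x p
cube⊆-∷ zero    _   _   _ (true ∷ x)  ()
cube⊆-∷ (suc d) _   _   h (false ∷ x) p = h x (cube-suc d x p)
cube⊆-∷ (suc d) smd d<n h (true ∷ x)  p with cube-extend d x d<n p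
... | j , xⱼ≡0 , q = IsSMD-shift₀ smd x j xⱼ≡0 (h (x ⊕ e j) q)

cube⊆SMD : ∀ {n d} {H A : PSet n} → Aff d H → IsSMD A → H ⊆ A → cube d ⊆ A
cube⊆SMD (point p)                _   H⊆A [] _ = H⊆A [] p
cube⊆SMD {d = d} (only₀ a _)      smd H⊆A =
  cube⊆-∷ d smd (Aff-dim≤ a) (cube⊆SMD a (IsSMD-half false smd) (λ x → H⊆A (false ∷ x)))
cube⊆SMD {d = d} (only₁ _ a)      smd H⊆A =
  cube⊆-∷ d smd (Aff-dim≤ a) (cube⊆SMD a (IsSMD-half false smd) (λ x p → IsSMD-down₀ smd x (H⊆A (true ∷ x) p)))
cube⊆SMD {d = suc d} {A = A} (both a s h) smd H⊆A = λ
  { (true ∷ x)  p → cube⊆A₁ x p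
  ; (false ∷ x) p → IsSMD-down₀ smd x (cube⊆A₁ x p) }
  where
  cube⊆A₁ : cube d ⊆ (λ x → A (true ∷ x))
  cube⊆A₁ =
    cube⊆SMD (Aff-cong (Aff-translate a s) (λ x → sym (h x))) (IsSMD-half true smd) (λ x → H⊆A (true ∷ x))

-- A point of the lower half outside 𝟎 could be shifted into the (empty) upper half.
SMD-half₀⊆cube-zero : ∀ {n} {A : PSet (suc n)} → IsSMD A → (∀ x → A (true ∷ x) ≡ false) →
                      ∀ x → (false ∷ x) ∈ A → x ∈ cube 0
SMD-half₀⊆cube-zero {A = A} smd A₁≡∅ x p with cube 0 x in x∉cube
... | true  = refl
... | false with cube-zero-witness x x∉cube
...   | j , xⱼ≡1 = contradiction (trans (sym (A₁≡∅ y)) (IsSMD-shift₀ smd y j yⱼ≡0 y⊕eⱼ∈A)) λ ()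
  where
  y : Pt _
  y = x ⊕ e j
  yⱼ≡0 : lookup y j ≡ false
  yⱼ≡0 = trans (lookup-⊕-e x j) (cong not xⱼ≡1)
  y⊕eⱼ∈A : (false ∷ (y ⊕ e j)) ∈ A
  y⊕eⱼ∈A = subst (λ z → (false ∷ z) ∈ A) (sym (⊕-cancelʳ x (e j))) p

SMD⊆cube : ∀ {n d} {H A : PSet n} → Aff d H → IsSMD A → A ⊆ H → A ⊆ cube d
SMD⊆cube (point _) _ _ [] _ = refl
SMD⊆cube {d = d} {A = A} (only₀ _ h) smd A⊆H = λ
  { (false ∷ x) p → cube-zero⊆ d (false ∷ x) (SMD-half₀⊆cube-zero smd A₁≡∅ x p)
  ; (true ∷ x)  p → contradiction (trans (sym p) (A₁≡∅ x)) λ () }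
  where
  A₁≡∅ : ∀ x → A (true ∷ x) ≡ false
  A₁≡∅ x with A (true ∷ x) in p
  ... | true  = contradiction (trans (sym (A⊆H (true ∷ x) p)) (h x)) λ ()
  ... | false = refl
SMD⊆cube (only₁ h _) smd A⊆H = λ
  { (false ∷ x) p → contradiction (trans (sym (A⊆H _ p)) (h x)) λ ()
  ; (true ∷ x)  p → contradiction (trans (sym (A⊆H _ (IsSMD-down₀ smd x p))) (h x)) λ () }
SMD⊆cube {d = suc d} {A = A} (both a _ _) smd A⊆H = λ
  { (false ∷ x) p → A₀⊆cube x p
  ; (true ∷ x)  p → A₀⊆cube x (IsSMD-down₀ smd x p) }
  where
  A₀⊆cube : (λ x → A (false ∷ x)) ⊆ cube d
  A₀⊆cube = SMD⊆cube a (IsSMD-half false smd) (λ x → A⊆H (false ∷ x))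

SMD≐cube : ∀ {n d} {H A : PSet n} → Aff d H → IsSMD A → A ≐ H → A ≐ cube d
SMD≐cube aff smd A≐H z =
  bool-ext (SMD⊆cube aff smd (λ x p → trans (sym (A≐H x)) p) z) (cube⊆SMD aff smd (λ x p → trans (A≐H x) p) z)

lemma2p19 : (n : ℕ) (A H : PSet n) (d : ℕ) → IsSMD A → IsAffine d H →
    ((J : Subset n) → IsAffine d (C J H))
    × (IsSMD H ⇔ (H ≐ cube d))
    × (H ⊆ A → cube d ⊆ A)
    × (A ⊆ H → A ⊆ cube d)
    × (A ≐ H → A ≐ cube d)
lemma2p19 n A H d smdA affH =
    C-IsAffine affH
  , mk⇔ (λ smdH → SMD≐cube aff smdH (λ _ → refl)) (λ H≐cube → IsSMD-cong (cube-IsSMD d) (λ x → sym (H≐cube x)))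
  , cube⊆SMD aff smdA
  , SMD⊆cube aff smdA
  , SMD≐cube aff smdA
  where
  aff : Aff d H
  aff = IsAffine⇒Aff affH
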